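{- (1) For any tree $T$ and any $n>2(\Delta(T)-1)$, $h(n,T)\ge n(\Delta(T)-1)$. (2) For any tree $T$, $h(n,T)\ge (3\Delta^*(T)-3)(n-3\Delta^*(T)+3)$.
   Context: For a graph $H$, $F_{H,1}$ is the set of maps $f:E(H)\to E(H)$ with $f(e)\ne e$ for all $e$. A subgraph $G'$ of $H$ is $f$-free if $f(e)\notin E(G')$ for all $e\in E(G')$. $h(n,G)$ is the maximum number of edges of an $n$-vertex graph $H$ for which some $f\in F_{H,1}$ exists with no $f$-free copy of $G$ in $H$. $\Delta(T)$ is the maximum degree. For a tree $T$ with bipartition $(A,B)$, let $\Delta(A)=\max\{d_T(u):u\in A\}$, $\Delta(B)=\max\{d_T(u):u\in B\}$, and $\Delta^*(T)=\min\{\Delta(A),\Delta(B)\}$. -}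

module Defs where

open import Data.Nat as ℕ using (ℕ; zero; suc; _⊔_; _⊓_)
open import Data.Fin as Fin using (Fin; _≟_)
open import Data.Fin.Properties using ()
open import Data.List using (List; []; _∷_; map; foldr; filter; allFin)
open import Data.Nat.ListAction using (sum)
open import Data.Integer as ℤ using (ℤ; +_)
open import Data.Bool using (Bool; true; false; if_then_else_; _∨_)
open import Data.Product using (Σ; Σ-syntax; ∃; ∃-syntax; _×_; _,_; proj₁; proj₂)
open import Data.Sum using (_⊎_)
open import Data.Empty using (⊥)
open import Relation.Nullary using (¬_)
open import Relation.Nullary.Decidable using (⌊_⌋)
open import Relation.Binary.PropositionalEquality using (_≡_; _≢_)
open import Function.Definitions using (Injective)

-- Edge e joins proj₁ (edge e) and proj₂ (edge e); the pair is stored with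
-- the smaller endpoint first (so no loops), and distinct edge indices are
-- distinct edges (no multi-edges).  E(H) is identified with Fin m.
record Graph (n : ℕ) : Set where
  field
    m        : ℕ
    edge     : Fin m → Fin n × Fin n
    edge-lt  : ∀ e → proj₁ (edge e) Fin.< proj₂ (edge e)
    edge-inj : Injective _≡_ _≡_ edge
open Graph public

Adj : ∀ {n} → Graph n → Fin n → Fin n → Set
Adj G u v = ∃[ e ] (edge G e ≡ (u , v) ⊎ edge G e ≡ (v , u))

data Reach {n} (G : Graph n) : Fin n → Fin n → Set where
  here : ∀ {u} → Reach G u u
  step : ∀ {u v w} → Adj G u v → Reach G v w → Reach G u w

Connected : ∀ {n} → Graph n → Set
Connected {n} G = ∀ (u v : Fin n) → Reach G u v

IsTree : ∀ {k} → Graph k → Set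
IsTree {k} T = Connected T × (m T ℕ.+ 1 ≡ k)

incident : ∀ {n} (G : Graph n) → Fin n → Fin (m G) → Bool
incident G v e = ⌊ proj₁ (edge G e) ≟ v ⌋ ∨ ⌊ proj₂ (edge G e) ≟ v ⌋

deg : ∀ {n} → Graph n → Fin n → ℕ
deg G v = sum (map (λ e → if incident G v e then 1 else 0) (allFin (m G)))

maxList : List ℕ → ℕ
maxList = foldr _⊔_ 0

Δ : ∀ {n} → Graph n → ℕ
Δ {n} G = maxList (map (deg G) (allFin n))

-- a proper 2-colouring; for a tree it gives the bipartition (A,B) with
-- A = colour true, B = colour false
Proper2Col : ∀ {n} → Graph n → (Fin n → Bool) → Set
Proper2Col G c = ∀ e → c (proj₁ (edge G e)) ≢ c (proj₂ (edge G e))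

Δpart : ∀ {n} → Graph n → (Fin n → Bool) → Bool → ℕ
Δpart {n} G c b = maxList (map (deg G) (filter (λ v → Data.Bool._≟_ (c v) b) (allFin n)))

Δ* : ∀ {n} → Graph n → (Fin n → Bool) → ℕ
Δ* G c = Δpart G c true ⊓ Δpart G c false

F1 : ∀ {n} → Graph n → Set
F1 H = Σ[ f ∈ (Fin (m H) → Fin (m H)) ] (∀ e → f e ≢ e)

-- A copy of G in H: an injective vertex map φ together with, for each
-- edge t of G, the edge ψ t of H onto which it is mapped.  The edge set of
-- the copy (a subgraph of H) is the image of ψ.
record Copy {n k} (H : Graph n) (G : Graph k) : Set where
  field
    φ     : Fin k → Fin n
    φ-inj : Injective _≡_ _≡_ φ
    ψ     : Fin (m G) → Fin (m H)
    ψ-ok  : ∀ t → edge H (ψ t) ≡ (φ (proj₁ (edge G t)) , φ (proj₂ (edge G t)))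
                ⊎ edge H (ψ t) ≡ (φ (proj₂ (edge G t)) , φ (proj₁ (edge G t)))
open Copy public

FFree : ∀ {n k} {H : Graph n} {G : Graph k} → (Fin (m H) → Fin (m H)) → Copy H G → Set
FFree f C = ∀ t t' → f (ψ C t) ≢ ψ C t'

Bad : ∀ {n k} → Graph n → Graph k → Set
Bad H G = Σ[ F ∈ F1 H ] (¬ (Σ[ C ∈ Copy H G ] FFree (proj₁ F) C))

-- "h(n,G) ≥ r" (h is a maximum): some n-vertex H with at least r edges is Bad
h≥ : ∀ {k} → ℕ → Graph k → ℕ → Set
h≥ n G r = Σ[ H ∈ Graph n ] (r ℕ.≤ m H × Bad H G)

-- "h(n,G) ≥ r" for an integer bound r (needed when r may be negative)
h≥ℤ : ∀ {k} → ℕ → Graph k → ℤ → Set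
h≥ℤ n G r = Σ[ H ∈ Graph n ] (r ℤ.≤ + (m H) × Bad H G)

{-# OPTIONS --safe #-}
module Submission where

-- Both bounds come from a host graph H with a map f such that, at some vertex w, the edges of H
-- fall into d classes and any two edges of one class are f-images of one another.  A copy of T
-- that sends a vertex of degree > d to w contains two edges of one class (pigeonhole), so it is
-- not f-free.
-- (1) The circulant graph on ℤ/n with steps 1, …, Δ-1 (simple because 2(Δ-1) < n), where f sends
--     {i, i+s} to {i+s, i+2s}: the classes are the steps and every vertex qualifies, in particular
--     the image of a vertex of maximum degree.
-- (2) K(3e, n-3e) with e = Δ*-1, the 3e left vertices grouped in e triples, where f rotates the
--     left end of an edge inside its triple: at a right vertex the classes are the triples.  The
--     two colour classes of T contain vertices of degree ≥ Δ*, and since T is connected they land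
--     on different sides of H, so one of them lands on the right.  If Δ* = 0 or 3e > n the bound
--     is ≤ 0 and the empty graph suffices.

module Lemmas where

  open import Defs
  open import Data.Bool as Bool using (Bool; true; false; not; _xor_; T; T?; if_then_else_)
  open import Data.Bool.Properties using (¬-not; not-distribˡ-xor; xor-same; T-∨)
  open import Data.Empty using (⊥-elim)
  open import Data.Fin as Fin using (Fin; toℕ; combine; remQuot; _↑ˡ_; _↑ʳ_)
  open import Data.Fin.Patterns using (0F; 1F; 2F)
  import Data.Fin.Properties as Fin
  open import Data.List using (List; []; _∷_; map; filter; allFin; length; lookup)
  open import Data.List.Membership.Propositional using (_∈_; find)
  open import Data.List.Membership.Propositional.Properties using (∈-filter⁻; ∈-lookup)
  open import Data.List.Relation.Unary.All as All using ()
  open import Data.List.Relation.Unary.Any using (Any; here; there; satisfied)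
  open import Data.List.Relation.Unary.AllPairs using (_∷_)
  open import Data.List.Relation.Unary.Unique.Propositional using (Unique)
  open import Data.List.Relation.Unary.Unique.Propositional.Properties using (filter⁺; allFin⁺)
  open import Data.Nat as ℕ
    using (ℕ; zero; suc; _+_; _*_; _∸_; _≤_; _<_; z≤n; z<s; NonZero; >-nonZero)
  open import Data.Nat.ListAction using (sum)
  open import Data.Integer as ℤ using (ℤ; +_; 0ℤ; +≤+)
  open import Data.Integer.Properties as ℤ
    using (pos-*; pos-+; *-monoˡ-≤-nonNeg; *-monoˡ-≤-nonPos; i≤j⇒i-j≤0)
  open import Data.Integer.Tactic.RingSolver using (solve-∀)
  open import Data.Nat.DivMod
    using (_%_; _/_; _mod_; m%n<n; m%n%n≡m%n; %-distribˡ-+; [m+n]%n≡m%n; m<n⇒m%n≡m; m≡m%n+[m/n]*n)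
  open import Data.Nat.Divisibility using (_∣_; divides; ∣⇒≤)
  open import Data.Nat.Properties as ℕ
    using ( ⊔-sel; <-cmp; +-assoc; +-cancelˡ-≡; m+[n∸m]≡n; m≤n⇒∃[o]m+o≡n; m<n⇒0<n∸m; m∸n≤m
          ; <⇒≤; <⇒≱; ≤-<-trans; ≤-trans; +-mono-≤; m≤m+n; ≤-refl)
  open import Data.Product as Product
    using (Σ-syntax; ∃-syntax; ∃₂; _×_; _,_; proj₁; proj₂; swap; uncurry)
  open import Data.Sum as Sum using (_⊎_; inj₁; inj₂; [_,_])
  open import Function using (_∘_; id; const; Injective; Equivalence)
  open import Relation.Nullary using (¬_; yes; no; contradiction)
  open import Relation.Nullary.Decidable using (toWitness)
  open import Relation.Binary.Definitions using (tri<; tri≈; tri>)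
  open import Relation.Binary.PropositionalEquality
    using (_≡_; _≢_; refl; sym; trans; cong; cong₂; subst; subst₂; module ≡-Reasoning)

  module _ {a} {A : Set a} where

    sum-if≡length-filter : ∀ (p : A → Bool) xs →
      sum (map (λ x → if p x then 1 else 0) xs) ≡ length (filter (T? ∘ p) xs)
    sum-if≡length-filter p [] = refl
    sum-if≡length-filter p (x ∷ xs) with p x
    ... | true  = cong suc (sum-if≡length-filter p xs)
    ... | false = sum-if≡length-filter p xs

    lookup-injective : ∀ {xs : List A} → Unique xs → ∀ i j → lookup xs i ≡ lookup xs j → i ≡ j
    lookup-injective (_ ∷ _)  Fin.zero    Fin.zero    _  = refl
    lookup-injective (x∉ ∷ _) Fin.zero    (Fin.suc j) eq = contradiction eq (All.lookup x∉ (∈-lookup j))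
    lookup-injective (x∉ ∷ _) (Fin.suc i) Fin.zero    eq = contradiction (sym eq) (All.lookup x∉ (∈-lookup i))
    lookup-injective (_ ∷ u)  (Fin.suc i) (Fin.suc j) eq = cong Fin.suc (lookup-injective u i j eq)

    pigeonhole-Unique : ∀ {d} {xs : List A} → Unique xs → d < length xs → (g : A → Fin d) →
      ∃₂ λ x y → x ∈ xs × y ∈ xs × x ≢ y × g x ≡ g y
    pigeonhole-Unique {xs = xs} u d<len g =
      let i , j , i<j , gi≡gj = Fin.pigeonhole d<len (g ∘ lookup xs)
      in lookup xs i , lookup xs j , ∈-lookup i , ∈-lookup j ,
         Fin.<⇒≢ i<j ∘ lookup-injective u i j , gi≡gj

    v<maxList⁻ : ∀ {v} (g : A → ℕ) xs → v < maxList (map g xs) → Any (λ x → v < g x) xs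
    v<maxList⁻ g (x ∷ xs) v<max with ⊔-sel (g x) (maxList (map g xs))
    ... | inj₁ eq = here (subst (_ <_) eq v<max)
    ... | inj₂ eq = there (v<maxList⁻ g xs (subst (_ <_) eq v<max))

    Linked : (A → A) → A → A → Set a
    Linked f x y = f x ≡ y ⊎ f y ≡ x

    _∈ₚ_ : A → A × A → Set a
    x ∈ₚ p = proj₁ p ≡ x ⊎ proj₂ p ≡ x

    _≐_ : A × A → A × A → Set a
    p ≐ q = p ≡ q ⊎ p ≡ swap q

    ≐-sym : ∀ {p q} → p ≐ q → q ≐ p
    ≐-sym (inj₁ refl) = inj₁ refl
    ≐-sym (inj₂ refl) = inj₂ refl

    ≐-trans : ∀ {p q r} → p ≐ q → q ≐ r → p ≐ r
    ≐-trans (inj₁ refl) q≐r = q≐r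
    ≐-trans (inj₂ refl) (inj₁ refl) = inj₂ refl
    ≐-trans (inj₂ refl) (inj₂ refl) = inj₁ refl

    ∈ₚ-resp-≐ : ∀ {x p q} → p ≐ q → x ∈ₚ p → x ∈ₚ q
    ∈ₚ-resp-≐ (inj₁ refl) = id
    ∈ₚ-resp-≐ (inj₂ refl) = Sum.swap

  module _ {a b} {A : Set a} {B : Set b} {f : A → B} where

    ∈ₚ-map⁺ : ∀ {x p} → x ∈ₚ p → f x ∈ₚ Product.map f f p
    ∈ₚ-map⁺ = Sum.map (cong f) (cong f)

    ≐-map⁻ : Injective _≡_ _≡_ f → ∀ {p q} → Product.map f f p ≐ Product.map f f q → p ≐ q
    ≐-map⁻ f-inj = Sum.map unmap unmap
      where
      unmap : ∀ {p q} → Product.map f f p ≡ Product.map f f q → p ≡ q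
      unmap eq = cong₂ _,_ (f-inj (cong proj₁ eq)) (f-inj (cong proj₂ eq))

  module _ {n : ℕ} where

    ordered-≐⇒≡ : ∀ {p q : Fin n × Fin n} →
      proj₁ p Fin.< proj₂ p → proj₁ q Fin.< proj₂ q → p ≐ q → p ≡ q
    ordered-≐⇒≡ _   _   (inj₁ p≡q)  = p≡q
    ordered-≐⇒≡ p<p q<q (inj₂ refl) = contradiction p<p (Fin.<-asym q<q)

    sort : Fin n → Fin n → Fin n × Fin n
    sort i j with i Fin.<? j
    ... | yes _ = i , j
    ... | no  _ = j , i

    sort-≐ : ∀ i j → sort i j ≐ (i , j)
    sort-≐ i j with i Fin.<? j
    ... | yes _ = inj₁ refl
    ... | no  _ = inj₂ refl

    sort-ordered : ∀ {i j} → i ≢ j → proj₁ (sort i j) Fin.< proj₂ (sort i j)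
    sort-ordered {i} {j} i≢j with i Fin.<? j
    ... | yes i<j = i<j
    ... | no  i≮j = Fin.≤∧≢⇒< (ℕ.≮⇒≥ i≮j) (i≢j ∘ sym)

  remQuot-injective : ∀ {m} k {x y : Fin (m * k)} → remQuot {m} k x ≡ remQuot k y → x ≡ y
  remQuot-injective {m} k {x} {y} eq = trans (sym (Fin.combine-remQuot {m} k x))
    (trans (cong (uncurry combine) eq) (Fin.combine-remQuot {m} k y))

  module _ {n} (G : Graph n) where

    edge-≐-injective : ∀ {e e'} → edge G e ≐ edge G e' → e ≡ e'
    edge-≐-injective {e} {e'} = edge-inj G ∘ ordered-≐⇒≡ (edge-lt G e) (edge-lt G e')

    incidentEdges : Fin n → List (Fin (m G))
    incidentEdges v = filter (T? ∘ incident G v) (allFin (m G))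

    deg≡length-incidentEdges : ∀ v → deg G v ≡ length (incidentEdges v)
    deg≡length-incidentEdges v = sum-if≡length-filter (incident G v) (allFin (m G))

    incidentEdges-unique : ∀ v → Unique (incidentEdges v)
    incidentEdges-unique v = filter⁺ (T? ∘ incident G v) (allFin⁺ (m G))

    ∈-incidentEdges⇒∈ₚ : ∀ {v e} → e ∈ incidentEdges v → v ∈ₚ edge G e
    ∈-incidentEdges⇒∈ₚ {v} {e} e∈ = Sum.map (toWitness {a? = proj₁ (edge G e) Fin.≟ v})
      (toWitness {a? = proj₂ (edge G e) Fin.≟ v})
      (Equivalence.to T-∨ (proj₂ (∈-filter⁻ (T? ∘ incident G v) {xs = allFin (m G)} e∈)))

    Proper2Col-Adj : ∀ {c} → Proper2Col G c → ∀ {u v} → Adj G u v → c u ≢ c v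
    Proper2Col-Adj proper (e , inj₁ refl) = proper e
    Proper2Col-Adj proper (e , inj₂ refl) = proper e ∘ sym

    Proper2Col-xor-invariant : ∀ {c c'} → Proper2Col G c → Proper2Col G c' →
      ∀ {u v} → Reach G u v → c u xor c v ≡ c' u xor c' v
    Proper2Col-xor-invariant {c} {c'} _ _ {u} here = trans (xor-same (c u)) (sym (xor-same (c' u)))
    Proper2Col-xor-invariant {c} {c'} proper proper' {u} {w} (step {v = v} adj r) = begin
      c u xor c w             ≡⟨ cong (_xor c w) (¬-not (Proper2Col-Adj {c} proper adj)) ⟩
      not (c v) xor c w       ≡⟨ not-distribˡ-xor (c v) (c w) ⟨
      not (c v xor c w)       ≡⟨ cong not (Proper2Col-xor-invariant {c} {c'} proper proper' r) ⟩
      not (c' v xor c' w)     ≡⟨ not-distribˡ-xor (c' v) (c' w) ⟩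
      not (c' v) xor c' w     ≡⟨ cong (_xor c' w) (¬-not (Proper2Col-Adj {c'} proper' adj)) ⟨
      c' u xor c' w           ∎
      where open ≡-Reasoning

  module _ {n k} {H : Graph n} {T : Graph k} (C : Copy H T) where

    ψ-∈ₚ : ∀ {u t} → u ∈ₚ edge T t → φ C u ∈ₚ edge H (ψ C t)
    ψ-∈ₚ {t = t} = ∈ₚ-resp-≐ (≐-sym (ψ-ok C t)) ∘ ∈ₚ-map⁺

    ψ-injective : Injective _≡_ _≡_ (ψ C)
    ψ-injective {t} {t'} ψt≡ψt' = edge-≐-injective T (≐-map⁻ (φ-inj C)
      (≐-trans (≐-sym (ψ-ok C t)) (subst (λ e → edge H e ≐ _) (sym ψt≡ψt') (ψ-ok C t'))))

    Proper2Col-pullback : ∀ {c} → Proper2Col H c → Proper2Col T (c ∘ φ C)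
    Proper2Col-pullback {c} proper t with ψ-ok C t
    ... | inj₁ eq = subst (λ p → c (proj₁ p) ≢ c (proj₂ p)) eq (proper (ψ C t))
    ... | inj₂ eq = subst (λ p → c (proj₁ p) ≢ c (proj₂ p)) eq (proper (ψ C t)) ∘ sym

  LinkedClassesAt : ∀ {n} (H : Graph n) → (Fin (m H) → Fin (m H)) → ℕ → Fin n → Set
  LinkedClassesAt H f d w = Σ[ class ∈ (Fin (m H) → Fin d) ] ∀ {e e'} →
    w ∈ₚ edge H e → w ∈ₚ edge H e' → e ≢ e' → class e ≡ class e' → Linked f e e'

  LinkedClassesAt⇒¬FFree : ∀ {n k} {H : Graph n} {T : Graph k} {f d v} (C : Copy H T) →
    LinkedClassesAt H f d (φ C v) → d < deg T v → ¬ FFree f C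
  LinkedClassesAt⇒¬FFree {T = T} {d = d} {v} C (class , linked) d<deg free =
    let t , t' , t∈ , t'∈ , t≢t' , same =
          pigeonhole-Unique (incidentEdges-unique T v)
            (subst (d <_) (deg≡length-incidentEdges T v) d<deg) (class ∘ ψ C)
    in [ free t t' , free t' t ]
         (linked (ψ-∈ₚ C (∈-incidentEdges⇒∈ₚ T t∈)) (ψ-∈ₚ C (∈-incidentEdges⇒∈ₚ T t'∈))
                 (t≢t' ∘ ψ-injective C) same)

  emptyGraph : ∀ n → Graph n
  emptyGraph n = record { m = 0 ; edge = λ () ; edge-lt = λ () ; edge-inj = λ { {()} } }

  emptyGraph-Bad : ∀ {n k} {T : Graph k} → 1 ≤ m T → Bad (emptyGraph n) T
  emptyGraph-Bad 1≤m = ((λ ()) , (λ ())) , λ (C , _) → Fin.¬Fin0 (ψ C (Fin.fromℕ< 1≤m))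

  h≥-emptyGraph : ∀ {n k r} {T : Graph k} → 1 ≤ m T → r ≤ 0 → h≥ n T r
  h≥-emptyGraph 1≤m r≤0 = emptyGraph _ , r≤0 , emptyGraph-Bad 1≤m

  h≥ℤ-emptyGraph : ∀ {n k r} {T : Graph k} → 1 ≤ m T → r ℤ.≤ 0ℤ → h≥ℤ n T r
  h≥ℤ-emptyGraph 1≤m r≤0 = emptyGraph _ , r≤0 , emptyGraph-Bad 1≤m

  module Rotation (n : ℕ) .{{_ : NonZero n}} where

    infixl 6 _⊕_
    _⊕_ : Fin n → ℕ → Fin n
    i ⊕ s = (toℕ i + s) mod n

    toℕ-⊕ : ∀ i s → toℕ (i ⊕ s) ≡ (toℕ i + s) % n
    toℕ-⊕ i s = Fin.toℕ-fromℕ< (m%n<n (toℕ i + s) n)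

    ⊕-assoc : ∀ i s t → i ⊕ s ⊕ t ≡ i ⊕ (s + t)
    ⊕-assoc i s t = Fin.toℕ-injective (begin
      toℕ (i ⊕ s ⊕ t)                    ≡⟨ toℕ-⊕ (i ⊕ s) t ⟩
      (toℕ (i ⊕ s) + t) % n              ≡⟨ cong (λ x → (x + t) % n) (toℕ-⊕ i s) ⟩
      ((toℕ i + s) % n + t) % n          ≡⟨ %-distribˡ-+ ((toℕ i + s) % n) t n ⟩
      ((toℕ i + s) % n % n + t % n) % n  ≡⟨ cong (λ x → (x + t % n) % n) (m%n%n≡m%n (toℕ i + s) n) ⟩
      ((toℕ i + s) % n + t % n) % n      ≡⟨ %-distribˡ-+ (toℕ i + s) t n ⟨
      (toℕ i + s + t) % n                ≡⟨ cong (_% n) (+-assoc (toℕ i) s t) ⟩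
      (toℕ i + (s + t)) % n              ≡⟨ toℕ-⊕ i (s + t) ⟨
      toℕ (i ⊕ (s + t))                  ∎)
      where open ≡-Reasoning

    ⊕-identity : ∀ i → i ⊕ n ≡ i
    ⊕-identity i = Fin.toℕ-injective
      (trans (toℕ-⊕ i n) (trans ([m+n]%n≡m%n (toℕ i) n) (m<n⇒m%n≡m (Fin.toℕ<n i))))

    ⊕-cancelʳ : ∀ {i j s} → s ≤ n → i ⊕ s ≡ j ⊕ s → i ≡ j
    ⊕-cancelʳ {i} {j} {s} s≤n eq = begin
      i                  ≡⟨ unshift i ⟨
      i ⊕ s ⊕ (n ∸ s)    ≡⟨ cong (_⊕ (n ∸ s)) eq ⟩
      j ⊕ s ⊕ (n ∸ s)    ≡⟨ unshift j ⟩
      j                  ∎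
      where
      open ≡-Reasoning
      unshift : ∀ i → i ⊕ s ⊕ (n ∸ s) ≡ i
      unshift i = trans (⊕-assoc i s (n ∸ s)) (trans (cong (i ⊕_) (m+[n∸m]≡n s≤n)) (⊕-identity i))

    ⊕-fixed⇒∣ : ∀ {i s} → i ⊕ s ≡ i → n ∣ s
    ⊕-fixed⇒∣ {i} {s} eq = divides ((toℕ i + s) / n) (+-cancelˡ-≡ (toℕ i) s _
      (trans (m≡m%n+[m/n]*n (toℕ i + s) n)
             (cong (_+ (toℕ i + s) / n * n) (trans (sym (toℕ-⊕ i s)) (cong toℕ eq)))))

    ⊕-fixedPointFree : ∀ {i s} → 0 < s → s < n → i ⊕ s ≢ i
    ⊕-fixedPointFree 0<s s<n eq = <⇒≱ s<n (∣⇒≤ {{>-nonZero 0<s}} (⊕-fixed⇒∣ eq))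

    ⊕-no-2-cycle : ∀ {i j s s'} → 0 < s → s + s' < n → i ⊕ s ≡ j → j ⊕ s' ≢ i
    ⊕-no-2-cycle {i} {s = s} {s'} 0<s s+s'<n i⊕s≡j j⊕s'≡i = ⊕-fixedPointFree
      (≤-trans 0<s (m≤m+n s s')) s+s'<n
      (trans (sym (⊕-assoc i s s')) (trans (cong (_⊕ s') i⊕s≡j) j⊕s'≡i))

    ⊕-injective-< : ∀ {i s s'} → s < s' → s' < n → i ⊕ s ≢ i ⊕ s'
    ⊕-injective-< {i} {s} {s'} s<s' s'<n eq =
      ⊕-fixedPointFree (m<n⇒0<n∸m s<s') (≤-<-trans (m∸n≤m s' s) s'<n)
        (trans (⊕-assoc i s (s' ∸ s)) (trans (cong (i ⊕_) (m+[n∸m]≡n (<⇒≤ s<s'))) (sym eq)))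

    ⊕-cancelˡ : ∀ {i s s'} → s < n → s' < n → i ⊕ s ≡ i ⊕ s' → s ≡ s'
    ⊕-cancelˡ {s = s} {s'} s<n s'<n eq with <-cmp s s'
    ... | tri< s<s' _ _ = contradiction eq (⊕-injective-< s<s' s'<n)
    ... | tri≈ _ s≡s' _ = s≡s'
    ... | tri> _ _ s'<s = contradiction (sym eq) (⊕-injective-< s'<s s<n)

  module Circulant (n d : ℕ) (2d<n : 2 * d < n) where

    instance
      n-nonZero : NonZero n
      n-nonZero = >-nonZero (≤-<-trans z≤n 2d<n)

    open Rotation n

    shift : Fin d → ℕ
    shift j = suc (toℕ j)

    shift+shift<n : ∀ j j' → shift j + shift j' < n
    shift+shift<n j j' =
      ≤-<-trans (+-mono-≤ (Fin.toℕ<n j) (≤-trans (Fin.toℕ<n j') (m≤m+n d 0))) 2d<n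

    shift<n : ∀ j → shift j < n
    shift<n j = ≤-<-trans (m≤m+n (shift j) (shift j)) (shift+shift<n j j)

    source : Fin (n * d) → Fin n
    source x = proj₁ (remQuot {n} d x)

    class : Fin (n * d) → Fin d
    class x = proj₂ (remQuot {n} d x)

    target : Fin (n * d) → Fin n
    target x = source x ⊕ shift (class x)

    ≡-by-source-class : ∀ {x x'} → source x ≡ source x' → class x ≡ class x' → x ≡ x'
    ≡-by-source-class p q = remQuot-injective d (cong₂ _,_ p q)

    class-≡-by-target : ∀ {x x'} → source x ≡ source x' → target x ≡ target x' → class x ≡ class x'
    class-≡-by-target {x} {x'} s≡ t≡ = Fin.toℕ-injective (ℕ.suc-injective
      (⊕-cancelˡ (shift<n (class x)) (shift<n (class x'))
        (trans t≡ (cong (_⊕ shift (class x')) (sym s≡)))))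

    source-≡-by-target : ∀ {x x'} → class x ≡ class x' → target x ≡ target x' → source x ≡ source x'
    source-≡-by-target {x} {x'} c≡ t≡ = ⊕-cancelʳ (<⇒≤ (shift<n (class x')))
      (trans (cong (λ j → source x ⊕ shift j) (sym c≡)) t≡)

    graph : Graph n
    graph = record
      { m        = n * d
      ; edge     = λ x → sort (source x) (target x)
      ; edge-lt  = λ x → sort-ordered (⊕-fixedPointFree z<s (shift<n (class x)) ∘ sym)
      ; edge-inj = edge-injective
      }
      where
      edge-injective : ∀ {x x'} → sort (source x) (target x) ≡ sort (source x') (target x') → x ≡ x'
      edge-injective {x} {x'} eq
        with ≐-trans (≐-sym (sort-≐ _ _)) (subst (_≐ _) (sym eq) (sort-≐ _ _))
      ... | inj₁ same = ≡-by-source-class (cong proj₁ same)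
              (class-≡-by-target (cong proj₁ same) (cong proj₂ same))
      ... | inj₂ swapped = ⊥-elim (⊕-no-2-cycle z<s (shift+shift<n (class x) (class x'))
              (cong proj₂ swapped) (sym (cong proj₁ swapped)))

    next : Fin (n * d) → Fin (n * d)
    next x = combine (target x) (class x)

    next-fixedPointFree : ∀ x → next x ≢ x
    next-fixedPointFree x eq = ⊕-fixedPointFree z<s (shift<n (class x))
      (trans (sym (cong proj₁ (Fin.remQuot-combine (target x) (class x)))) (cong source eq))

    next≡ : ∀ {x x'} → target x ≡ source x' → class x ≡ class x' → next x ≡ x'
    next≡ p q = remQuot-injective d (trans (Fin.remQuot-combine _ _) (cong₂ _,_ p q))

    -- The edges of class j at w are {w - shift j, w} and {w, w + shift j}; next maps the first
    -- to the second.
    linkedClasses : ∀ w → LinkedClassesAt graph next d w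
    linkedClasses w = class , linked
      where
      linked : ∀ {x x'} → w ∈ₚ edge graph x → w ∈ₚ edge graph x' → x ≢ x' →
               class x ≡ class x' → Linked next x x'
      linked {x} {x'} w∈x w∈x' x≢x' same
        with ∈ₚ-resp-≐ (sort-≐ _ _) w∈x | ∈ₚ-resp-≐ (sort-≐ _ _) w∈x'
      ... | inj₁ sx≡w | inj₁ sx'≡w =
            contradiction (≡-by-source-class (trans sx≡w (sym sx'≡w)) same) x≢x'
      ... | inj₂ tx≡w | inj₂ tx'≡w =
            contradiction (≡-by-source-class (source-≡-by-target same (trans tx≡w (sym tx'≡w))) same) x≢x'
      ... | inj₁ sx≡w | inj₂ tx'≡w = inj₂ (next≡ (trans tx'≡w (sym sx≡w)) (sym same))
      ... | inj₂ tx≡w | inj₁ sx'≡w = inj₁ (next≡ (trans tx≡w (sym sx'≡w)) same)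

  h≥-circulant : ∀ {k} (T : Graph k) {n d} → 2 * d < n → d < Δ T → h≥ n T (n * d)
  h≥-circulant {k} T {n} {d} 2d<n d<Δ with satisfied (v<maxList⁻ (deg T) (allFin k) d<Δ)
  ... | v , d<deg = graph , ≤-refl , (next , next-fixedPointFree) ,
    λ (C , free) → LinkedClassesAt⇒¬FFree C (linkedClasses (φ C v)) d<deg free
    where open Circulant n d 2d<n

  h≥-Δ : ∀ {k} (T : Graph k) → 1 ≤ m T → ∀ n → 2 * (Δ T ∸ 1) < n → h≥ n T (n * (Δ T ∸ 1))
  h≥-Δ T 1≤m n with Δ T in Δ≡
  ... | zero  = λ _ → h≥-emptyGraph 1≤m (ℕ.≤-reflexive (ℕ.*-zeroʳ n))
  ... | suc d = λ 2d<n → h≥-circulant T 2d<n (subst (d <_) (sym Δ≡) ≤-refl)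

  module CompleteBipartite (a r : ℕ) where

    left : Fin (a * r) → Fin a
    left x = proj₁ (remQuot {a} r x)

    right : Fin (a * r) → Fin r
    right x = proj₂ (remQuot {a} r x)

    graph : Graph (a + r)
    graph = record
      { m        = a * r
      ; edge     = λ x → left x ↑ˡ r , a ↑ʳ right x
      ; edge-lt  = λ x → subst₂ _<_ (sym (Fin.toℕ-↑ˡ (left x) r)) (sym (Fin.toℕ-↑ʳ a (right x)))
                           (≤-trans (Fin.toℕ<n (left x)) (m≤m+n a (toℕ (right x))))
      ; edge-inj = λ eq → remQuot-injective r (cong₂ _,_ (Fin.↑ˡ-injective r _ _ (cong proj₁ eq))
                                                         (Fin.↑ʳ-injective a _ _ (cong proj₂ eq)))
      }

    isLeft : Fin (a + r) → Bool
    isLeft w = [ const true , const false ] (Fin.splitAt a w)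

    isLeft-↑ˡ : ∀ s → isLeft (s ↑ˡ r) ≡ true
    isLeft-↑ˡ s = cong [ const true , const false ] (Fin.splitAt-↑ˡ a s r)

    isLeft-↑ʳ : ∀ l → isLeft (a ↑ʳ l) ≡ false
    isLeft-↑ʳ l = cong [ const true , const false ] (Fin.splitAt-↑ʳ a r l)

    isLeft-proper : Proper2Col graph isLeft
    isLeft-proper x = subst₂ _≢_ (sym (isLeft-↑ˡ (left x))) (sym (isLeft-↑ʳ (right x))) (λ ())

    ∈ₚ-right : ∀ {w x} → isLeft w ≡ false → w ∈ₚ edge graph x → a ↑ʳ right x ≡ w
    ∈ₚ-right {x = x} w-right (inj₁ eq) =
      contradiction (trans (sym (isLeft-↑ˡ (left x))) (trans (cong isLeft eq) w-right)) (λ ())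
    ∈ₚ-right _ (inj₂ eq) = eq

    lift : (Fin a → Fin a) → Fin (a * r) → Fin (a * r)
    lift π x = combine (π (left x)) (right x)

    lift-fixedPointFree : ∀ {π} → (∀ s → π s ≢ s) → ∀ x → lift π x ≢ x
    lift-fixedPointFree π-fpf x eq =
      π-fpf (left x) (trans (sym (cong proj₁ (Fin.remQuot-combine _ (right x)))) (cong left eq))

    linkedClasses-right : ∀ {d} (π : Fin a → Fin a) (class : Fin a → Fin d) →
      (∀ {s s'} → s ≢ s' → class s ≡ class s' → Linked π s s') →
      ∀ {w} → isLeft w ≡ false → LinkedClassesAt graph (lift π) d w
    linkedClasses-right π class π-linked w-right = class ∘ left , linked
      where
      linked : ∀ {x x'} → _ ∈ₚ edge graph x → _ ∈ₚ edge graph x' → x ≢ x' →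
               class (left x) ≡ class (left x') → Linked (lift π) x x'
      linked {x} {x'} w∈x w∈x' x≢x' same =
        Sum.map (λ p → lift≡ p right≡) (λ p → lift≡ p (sym right≡))
                (π-linked (λ left≡ → x≢x' (remQuot-injective r (cong₂ _,_ left≡ right≡))) same)
        where
        right≡ : right x ≡ right x'
        right≡ = Fin.↑ʳ-injective a _ _ (trans (∈ₚ-right w-right w∈x) (sym (∈ₚ-right w-right w∈x')))
        lift≡ : ∀ {y y'} → π (left y) ≡ left y' → right y ≡ right y' → lift π y ≡ y'
        lift≡ p q = remQuot-injective r (trans (Fin.remQuot-combine _ _) (cong₂ _,_ p q))

  cycle₃ : Fin 3 → Fin 3
  cycle₃ 0F = 1F
  cycle₃ 1F = 2F
  cycle₃ 2F = 0F

  cycle₃-fixedPointFree : ∀ b → cycle₃ b ≢ b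
  cycle₃-fixedPointFree 0F ()
  cycle₃-fixedPointFree 1F ()
  cycle₃-fixedPointFree 2F ()

  cycle₃-linked : ∀ {b b'} → b ≢ b' → Linked cycle₃ b b'
  cycle₃-linked {0F} {0F} b≢b' = contradiction refl b≢b'
  cycle₃-linked {0F} {1F} _ = inj₁ refl
  cycle₃-linked {0F} {2F} _ = inj₂ refl
  cycle₃-linked {1F} {0F} _ = inj₂ refl
  cycle₃-linked {1F} {1F} b≢b' = contradiction refl b≢b'
  cycle₃-linked {1F} {2F} _ = inj₁ refl
  cycle₃-linked {2F} {0F} _ = inj₁ refl
  cycle₃-linked {2F} {1F} _ = inj₂ refl
  cycle₃-linked {2F} {2F} b≢b' = contradiction refl b≢b'

  module BlockRotation (e : ℕ) where

    block : Fin (3 * e) → Fin 3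
    block s = proj₁ (remQuot {3} e s)

    slot : Fin (3 * e) → Fin e
    slot s = proj₂ (remQuot {3} e s)

    rotate : Fin (3 * e) → Fin (3 * e)
    rotate s = combine (cycle₃ (block s)) (slot s)

    rotate-fixedPointFree : ∀ s → rotate s ≢ s
    rotate-fixedPointFree s eq = cycle₃-fixedPointFree (block s)
      (trans (sym (cong proj₁ (Fin.remQuot-combine _ (slot s)))) (cong block eq))

    rotate-linked : ∀ {s s'} → s ≢ s' → slot s ≡ slot s' → Linked rotate s s'
    rotate-linked {s} {s'} s≢s' same =
      Sum.map (λ p → rotate≡ p same) (λ p → rotate≡ p (sym same))
              (cycle₃-linked (λ block≡ → s≢s' (remQuot-injective e (cong₂ _,_ block≡ same))))
      where
      rotate≡ : ∀ {t t'} → cycle₃ (block t) ≡ block t' → slot t ≡ slot t' → rotate t ≡ t'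
      rotate≡ p q = remQuot-injective e (trans (Fin.remQuot-combine _ _) (cong₂ _,_ p q))

  vertexOfColour : ∀ {k} (T : Graph k) c b {d} → d < Δpart T c b → ∃[ v ] c v ≡ b × d < deg T v
  vertexOfColour {k} T c b d<Δ =
    let v , v∈ , d<deg = find (v<maxList⁻ (deg T) (filter (λ v → c v Bool.≟ b) (allFin k)) d<Δ)
    in v , proj₂ (∈-filter⁻ (λ v → c v Bool.≟ b) {xs = allFin k} v∈) , d<deg

  xor≡true⇒≡false⊎≡false : ∀ x y → x xor y ≡ true → x ≡ false ⊎ y ≡ false
  xor≡true⇒≡false⊎≡false false _     _ = inj₁ refl
  xor≡true⇒≡false⊎≡false true  false _ = inj₂ refl

  h≥ℤ-completeBipartite : ∀ {k} (T : Graph k) {c} → Connected T → Proper2Col T c → ∀ {e} →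
    (∀ b → ∃[ v ] c v ≡ b × e < deg T v) → ∀ r → h≥ℤ (3 * e + r) T (+ (3 * e * r))
  h≥ℤ-completeBipartite T {c} connected proper {e} vertexOf r =
    graph , ℤ.≤-refl , (lift rotate , lift-fixedPointFree rotate-fixedPointFree) ,
    λ (C , free) → let v , v-right , e<deg = rightVertex C in
      LinkedClassesAt⇒¬FFree C (linkedClasses-right rotate slot rotate-linked v-right) e<deg free
    where
    open CompleteBipartite (3 * e) r
    open BlockRotation e
    -- c and isLeft ∘ φ C both properly colour the connected T, so u and v, coloured
    -- differently by c, are also coloured differently by isLeft ∘ φ C.
    rightVertex : (C : Copy graph T) → ∃[ v ] isLeft (φ C v) ≡ false × e < deg T v
    rightVertex C with vertexOf true | vertexOf false
    ... | u , cu≡true , u-deg | v , cv≡false , v-deg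
      with xor≡true⇒≡false⊎≡false (isLeft (φ C u)) (isLeft (φ C v))
             (trans (sym (Proper2Col-xor-invariant T {c} {isLeft ∘ φ C} proper
                            (Proper2Col-pullback C {isLeft} isLeft-proper) (connected u v)))
                    (cong₂ _xor_ cu≡true cv≡false))
    ... | inj₁ u-right = u , u-right , u-deg
    ... | inj₂ v-right = v , v-right , v-deg

  bound₂ : ℕ → ℕ → ℤ
  bound₂ D n = ((+ 3) ℤ.* (+ D) ℤ.- + 3) ℤ.* ((+ n ℤ.- (+ 3) ℤ.* (+ D)) ℤ.+ + 3)

  bound₂-suc : ∀ e n → bound₂ (suc e) n ≡ + (3 * e) ℤ.* (+ n ℤ.- + (3 * e))
  bound₂-suc e n = trans (identity (+ e) (+ n)) (cong (λ y → y ℤ.* (+ n ℤ.- y)) (sym (pos-* 3 e)))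
    where
    identity : ∀ E N →
      ((+ 3) ℤ.* (+ 1 ℤ.+ E) ℤ.- + 3) ℤ.* ((N ℤ.- (+ 3) ℤ.* (+ 1 ℤ.+ E)) ℤ.+ + 3)
        ≡ ((+ 3) ℤ.* E) ℤ.* (N ℤ.- (+ 3) ℤ.* E)
    identity = solve-∀

  bound₂-suc-+ : ∀ e r → bound₂ (suc e) (3 * e + r) ≡ + (3 * e * r)
  bound₂-suc-+ e r = begin
    bound₂ (suc e) (a + r)                 ≡⟨ bound₂-suc e (a + r) ⟩
    + a ℤ.* (+ (a + r) ℤ.- + a)            ≡⟨ cong (λ z → + a ℤ.* (z ℤ.- + a)) (pos-+ a r) ⟩
    + a ℤ.* ((+ a ℤ.+ + r) ℤ.- + a)        ≡⟨ identity (+ a) (+ r) ⟩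
    + a ℤ.* + r                            ≡⟨ pos-* a r ⟨
    + (a * r)                              ∎
    where
    open ≡-Reasoning
    a = 3 * e
    identity : ∀ A R → A ℤ.* ((A ℤ.+ R) ℤ.- A) ≡ A ℤ.* R
    identity = solve-∀

  bound₂-zero≤0 : ∀ n → bound₂ 0 n ℤ.≤ 0ℤ
  bound₂-zero≤0 n = *-monoˡ-≤-nonPos ((+ 3) ℤ.* (+ 0) ℤ.- + 3)
    {0ℤ} {(+ n ℤ.- (+ 3) ℤ.* (+ 0)) ℤ.+ + 3} (+≤+ z≤n)

  bound₂-suc≤0 : ∀ e n → n ≤ 3 * e → bound₂ (suc e) n ℤ.≤ 0ℤ
  bound₂-suc≤0 e n n≤3e = begin
    bound₂ (suc e) n                   ≡⟨ bound₂-suc e n ⟩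
    + (3 * e) ℤ.* (+ n ℤ.- + (3 * e))  ≤⟨ *-monoˡ-≤-nonNeg (+ (3 * e)) (i≤j⇒i-j≤0 (+≤+ n≤3e)) ⟩
    + (3 * e) ℤ.* 0ℤ                   ≡⟨ ℤ.*-zeroʳ (+ (3 * e)) ⟩
    0ℤ                                 ∎
    where open ℤ.≤-Reasoning

  h≥ℤ-bound₂ : ∀ {k} (T : Graph k) {c} → Connected T → Proper2Col T c → 1 ≤ m T →
    ∀ D → D ≤ Δ* T c → ∀ n → h≥ℤ n T (bound₂ D n)
  h≥ℤ-bound₂ T connected proper 1≤m zero _ n = h≥ℤ-emptyGraph 1≤m (bound₂-zero≤0 n)
  h≥ℤ-bound₂ T {c} connected proper 1≤m (suc e) D≤Δ* n with 3 * e ℕ.≤? n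
  ... | no 3e≰n = h≥ℤ-emptyGraph 1≤m (bound₂-suc≤0 e n (ℕ.≰⇒≥ 3e≰n))
  ... | yes 3e≤n with m≤n⇒∃[o]m+o≡n 3e≤n
  ...   | r , refl = subst (h≥ℤ _ T) (sym (bound₂-suc-+ e r))
                       (h≥ℤ-completeBipartite T connected proper vertexOf r)
    where
    vertexOf : ∀ b → ∃[ v ] c v ≡ b × e < deg T v
    vertexOf true  = vertexOfColour T c true  (≤-trans D≤Δ* (ℕ.m⊓n≤m _ _))
    vertexOf false = vertexOfColour T c false (≤-trans D≤Δ* (ℕ.m⊓n≤n _ _))

open import Defs
open import Data.Nat using (ℕ; _≤_; _<_; _*_; _∸_)
open import Data.Integer using (ℤ; +_; _-_; _+_)
open import Data.Bool using (Bool)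
open import Data.Fin using (Fin)
open import Data.Product using (_×_)
import Data.Integer as Int
open import Data.Nat using (s≤s⁻¹)
open import Data.Nat.Properties using (≤-refl; +-comm)
open import Data.Product using (_,_)
open import Relation.Binary.PropositionalEquality using (subst; trans; sym)
open Lemmas using (h≥-Δ; h≥ℤ-bound₂)

proposition3p2 :
    ∀ {k} (T : Graph k) → IsTree T → 2 ≤ k →
      (∀ n → 2 * (Δ T ∸ 1) < n → h≥ n T (n * (Δ T ∸ 1)))
      × (∀ (c : Fin k → Bool) → Proper2Col T c → ∀ n →
           h≥ℤ n T (((+ 3) Int.* (+ Δ* T c) - + 3) Int.* ((+ n - (+ 3) Int.* (+ Δ* T c)) + + 3)))
proposition3p2 T (connected , m+1≡k) 2≤k =
  h≥-Δ T 1≤m , λ c proper → h≥ℤ-bound₂ T connected proper 1≤m (Δ* T c) ≤-refl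
  where
  1≤m : 1 ≤ m T
  1≤m = s≤s⁻¹ (subst (2 ≤_) (trans (sym m+1≡k) (+-comm (m T) 1)) 2≤k)
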